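{- Let $G$ be a graph with $n$ vertices. If the minimum degree satisfies $\delta(G)\geq 3$, then $\gamma_{2,2}(G)\leq \frac{6}{7}n$. If $\delta(G)\geq 4$, then $\gamma_{2,2}(G)\leq \frac{4}{5}n$.
   Context: All graphs are finite and simple. For nonnegative integers $a,b$, an $(a,b)$-dominating set of a graph $G$ is a subset $S\subseteq V(G)$ such that every vertex $v\in S$ is adjacent to at least $a$ vertices of $S$ and every vertex $v\in V(G)\setminus S$ is adjacent to at least $b$ vertices of $S$. $\gamma_{a,b}(G)$ denotes the minimum cardinality of an $(a,b)$-dominating set of $G$. $\delta(G)$ is the minimum degree of $G$. -}

module Defs where

open import Data.Nat using (ℕ; _≤_; _*_)
open import Data.Fin using (Fin)
open import Data.Fin.Subset using (Subset; _∈_; _∉_; ∣_∣)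
open import Data.Fin.Subset.Properties using (_∈?_)
open import Data.List using (List; filter; length; allFin)
open import Relation.Nullary using (¬_; Dec)
open import Relation.Nullary.Decidable using (_×-dec_)
open import Data.Product using (_×_)

record Graph (n : ℕ) : Set₁ where
  field
    Adj     : Fin n → Fin n → Set
    adj?    : (u v : Fin n) → Dec (Adj u v)
    sym     : ∀ {u v} → Adj u v → Adj v u
    irrefl  : ∀ {u} → ¬ Adj u u

open Graph public

deg : ∀ {n} (G : Graph n) → Fin n → ℕ
deg {n} G v = length (filter (λ u → adj? G v u) (allFin n))

degIn : ∀ {n} (G : Graph n) → Subset n → Fin n → ℕ
degIn {n} G S v = length (filter (λ u → (u ∈? S) ×-dec adj? G v u) (allFin n))

MinDegreeAtLeast : ∀ {n} → Graph n → ℕ → Set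
MinDegreeAtLeast G k = ∀ v → k ≤ deg G v

IsDominating : ∀ {n} (G : Graph n) (a b : ℕ) → Subset n → Set
IsDominating G a b S =
  (∀ v → v ∈ S → a ≤ degIn G S v) × (∀ v → v ∉ S → b ≤ degIn G S v)

module Submission where

-- Give every vertex v a family of c pairs of distinct neighbours of v
-- (a "pair scheme") such that any set I containing at most one vertex of each
-- pair misses at least two neighbours of v.  For δ ≥ 3 take three neighbours
-- a, b, c and the pairs ab, bc, ac (c = 3); for δ ≥ 4 take four neighbours
-- and the pairs ab, cd (c = 2).  The pairs form an auxiliary multigraph H on
-- the n vertices with c·n edges; if I is independent in H, its complement S
-- is a (2,2)-dominating set of G.  A greedy (Caro–Wei/Turán type) argument
-- gives an independent set of H with n ≤ (2c+1)·|I|, hence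
-- (2c+1)·|S| ≤ 2c·n, which is 7|S| ≤ 6n for c = 3 and 5|S| ≤ 4n for c = 2.

open import Defs
open import Data.Nat using (ℕ; _≤_; _*_)
open import Data.Fin.Subset using (Subset; ∣_∣)
open import Data.Product using (_×_; Σ-syntax)

open import Data.Nat using (zero; suc; _+_; _<ᵇ_; _≤ᵇ_; _≤?_; NonZero; z≤n; s≤s; compare; less; equal; greater)
open import Data.Nat.Properties
  using (≤-refl; ≤-trans; ≤-reflexive; ≤-pred; ≤ᵇ⇒≤; +-mono-≤; +-monoʳ-≤; *-monoʳ-≤; m≤m+n; m≤n+m;
         +-comm; +-identityʳ; *-comm; *-identityʳ; *-zeroʳ; *-distribˡ-+; +-cancelʳ-≤; *-cancelˡ-≤;
         +-*-semiring; m*n≢0; <⇒≤; ≰⇒>; module ≤-Reasoning)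
open import Data.Nat.Tactic.RingSolver using (solve-∀)
open import Data.Bool using (Bool; true; false; _∧_; _∨_; not; T)
open import Data.Bool.Properties using (∧-conicalˡ; ∧-conicalʳ; ∨-zeroʳ; not-injective)
open import Data.Fin using (Fin; zero; suc)
open import Data.Fin.Properties using (_≟_)
open import Data.Fin.Subset using (_∈_)
open import Data.Fin.Subset.Properties using (_∈?_)
open import Data.Vec using (tabulate)
open import Data.Vec.Properties using (lookup∘tabulate; lookup⇒[]=)
open import Data.Vec.Functional using (_∷_)
open import Data.List using (filter; length)
import Data.List as List
open import Data.Product using (_,_; proj₁; proj₂)
open import Data.Sum using (_⊎_; inj₁; inj₂)
open import Data.Empty using (⊥; ⊥-elim)
open import Function using (_∘_)
open import Function.Definitions using (Injective)
open import Relation.Nullary using (Dec; yes; no; does)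
open import Relation.Nullary.Decidable using (dec-true; _×-dec_)
open import Relation.Binary.PropositionalEquality
  using (_≡_; _≢_; refl; trans; cong; cong₂; subst; subst₂; module ≡-Reasoning)
  renaming (sym to ≡-sym)
open import Algebra.Properties.Semiring.Sum +-*-semiring
  using (sum; sum-syntax; sum-cong-≗; sum-replicate-zero; ∑-distrib-+; ∑-comm; *-distribˡ-sum)

ι : Bool → ℕ
ι true  = 1
ι false = 0

byComputation : ∀ {m n} → {T (m ≤ᵇ n)} → m ≤ n
byComputation {m} {n} {p} = ≤ᵇ⇒≤ m n p

false≢true : false ≢ true
false≢true ()

does⇒ : ∀ {A : Set} (d : Dec A) → does d ≡ true → A
does⇒ (yes a) _ = a
does⇒ (no _) ()

sum-mono : ∀ {k} {f g : Fin k → ℕ} → (∀ i → f i ≤ g i) → sum f ≤ sum g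
sum-mono {zero}  _   = z≤n
sum-mono {suc k} f≤g = +-mono-≤ (f≤g zero) (sum-mono (f≤g ∘ suc))

term≤sum : ∀ {k} (f : Fin k → ℕ) (i : Fin k) → f i ≤ sum f
term≤sum f zero    = m≤m+n _ _
term≤sum f (suc i) = ≤-trans (term≤sum (f ∘ suc) i) (m≤n+m _ _)

sum-const : ∀ k x → ∑[ i < k ] x ≡ k * x
sum-const zero    x = refl
sum-const (suc k) x = cong (x +_) (sum-const k x)

δ : ∀ {n} → Fin n → Fin n → ℕ
δ x u = ι (does (x ≟ u))

δ-diag : ∀ {n} (x : Fin n) → δ x x ≡ 1
δ-diag x = cong ι (dec-true (x ≟ x) refl)

sum-δ : ∀ {n} (x : Fin n) (g : Fin n → ℕ) → ∑[ u < n ] (δ x u * g u) ≡ g x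
sum-δ {suc n} zero g = begin
    (g zero + 0) + sum {n} (λ _ → 0)  ≡⟨ cong₂ _+_ (+-identityʳ (g zero)) (sum-replicate-zero n) ⟩
    g zero + 0                        ≡⟨ +-identityʳ (g zero) ⟩
    g zero                            ∎
  where open ≡-Reasoning
sum-δ (suc x) g = sum-δ x (g ∘ suc)

sum-δ-one : ∀ {n} (x : Fin n) → ∑[ u < n ] δ x u ≡ 1
sum-δ-one x = trans (sum-cong-≗ (λ u → ≡-sym (*-identityʳ (δ x u)))) (sum-δ x (λ _ → 1))

count : ∀ {n} → (Fin n → Bool) → ℕ
count {n} P = ∑[ u < n ] ι (P u)

count-all : ∀ n → count {n} (λ _ → true) ≡ n
count-all n = trans (sum-const n 1) (*-identityʳ n)

count-empty : ∀ {n} (P : Fin n → Bool) → (∀ u → P u ≡ false) → count P ≡ 0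
count-empty {n} P empty = trans (sum-cong-≗ (λ u → cong ι (empty u))) (sum-replicate-zero n)

count-split : ∀ {n} (P Q : Fin n → Bool) → count P ≡ count (λ u → P u ∧ not (Q u)) + count (λ u → P u ∧ Q u)
count-split P Q =
  trans (sum-cong-≗ (λ u → split (P u) (Q u))) (∑-distrib-+ (λ u → ι (P u ∧ not (Q u))) (λ u → ι (P u ∧ Q u)))
  where
  split : ∀ p q → ι p ≡ ι (p ∧ not q) + ι (p ∧ q)
  split true  true  = refl
  split true  false = refl
  split false _     = refl

pickOne : ∀ {n} (P : Fin n → Bool) → 1 ≤ count P → Σ[ a ∈ Fin n ] P a ≡ true
pickOne {suc n} P h with P zero in P0
... | true  = zero , P0
... | false with pickOne (P ∘ suc) h
...   | a , Pa = suc a , Pa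

_without_ : ∀ {n} → (Fin n → Bool) → Fin n → (Fin n → Bool)
(P without a) u = P u ∧ not (does (a ≟ u))

count-without : ∀ {n} (P : Fin n → Bool) (a : Fin n) → count P ≤ 1 + count (P without a)
count-without {n} P a = begin
    count P                                      ≤⟨ sum-mono (λ u → pointwise (P u) (does (a ≟ u))) ⟩
    ∑[ u < n ] (δ a u + ι ((P without a) u))     ≡⟨ ∑-distrib-+ (δ a) (λ u → ι ((P without a) u)) ⟩
    sum (δ a) + count (P without a)              ≡⟨ cong (_+ count (P without a)) (sum-δ-one a) ⟩
    1 + count (P without a)                      ∎
  where
  open ≤-Reasoning
  pointwise : ∀ p e → ι p ≤ ι e + ι (p ∧ not e)
  pointwise true  true  = ≤-refl
  pointwise true  false = ≤-refl
  pointwise false _     = z≤n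

count≥2 : ∀ {n} (Q : Fin n → Bool) {x y : Fin n} → x ≢ y → Q x ≡ true → Q y ≡ true → 2 ≤ count Q
count≥2 Q {x} {y} x≢y Qx Qy = begin
    2                                ≡⟨ ≡-sym (cong₂ _+_ (sum-δ-one x) (sum-δ-one y)) ⟩
    sum (δ x) + sum (δ y)            ≡⟨ ≡-sym (∑-distrib-+ (δ x) (δ y)) ⟩
    sum (λ u → δ x u + δ y u)        ≤⟨ sum-mono pointwise ⟩
    count Q                          ∎
  where
  open ≤-Reasoning
  pointwise : ∀ u → δ x u + δ y u ≤ ι (Q u)
  pointwise u with x ≟ u | y ≟ u
  ... | no _     | no _     = z≤n
  ... | yes refl | yes refl = ⊥-elim (x≢y refl)
  ... | yes refl | no _     = ≤-reflexive (cong ι (≡-sym Qx))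
  ... | no _     | yes refl = ≤-reflexive (cong ι (≡-sym Qy))

pickDistinct : ∀ {n} k (P : Fin n → Bool) → k ≤ count P →
               Σ[ f ∈ (Fin k → Fin n) ] (Injective _≡_ _≡_ f × (∀ i → P (f i) ≡ true))
pickDistinct zero    P _ = (λ ()) , (λ { {()} }) , (λ ())
pickDistinct (suc k) P h with pickOne P (≤-trans (s≤s z≤n) h)
... | a , Pa with pickDistinct k (P without a) (≤-pred (≤-trans h (count-without P a)))
...   | g , g-inj , Pg = (a ∷ g) , injective , holds
  where
  a∉g : ∀ j → a ≢ g j
  a∉g j a≡gj = false≢true (trans (cong not (≡-sym (dec-true (a ≟ g j) a≡gj))) (∧-conicalʳ _ _ (Pg j)))
  injective : Injective _≡_ _≡_ (a ∷ g)
  injective {zero}  {zero}  _ = refl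
  injective {zero}  {suc j} e = ⊥-elim (a∉g j e)
  injective {suc i} {zero}  e = ⊥-elim (a∉g i (≡-sym e))
  injective {suc i} {suc j} e = cong suc (g-inj e)
  holds : ∀ i → P ((a ∷ g) i) ≡ true
  holds zero    = Pa
  holds (suc i) = ∧-conicalˡ _ _ (Pg i)

argmin : ∀ {n} (V : Fin n → Bool) (f : Fin n → ℕ) →
         (∀ u → V u ≡ false) ⊎ Σ[ v ∈ Fin n ] (V v ≡ true × (∀ u → V u ≡ true → f v ≤ f u))
argmin {zero}  V f = inj₁ (λ ())
argmin {suc n} V f with argmin (V ∘ suc) (f ∘ suc) | V zero in V0
... | inj₁ empty | false = inj₁ λ { zero → V0 ; (suc u) → empty u }
... | inj₁ empty | true  = inj₂ (zero , V0 , λ { zero _ → ≤-refl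
                                              ; (suc u) Vu → ⊥-elim (false≢true (trans (≡-sym (empty u)) Vu)) })
... | inj₂ (v , Vv , min) | false = inj₂ (suc v , Vv , λ { zero V0' → ⊥-elim (false≢true (trans (≡-sym V0) V0'))
                                                         ; (suc u) Vu → min u Vu })
... | inj₂ (v , Vv , min) | true with f zero ≤? f (suc v)
...   | yes le = inj₂ (zero , V0 , λ { zero _ → ≤-refl ; (suc u) Vu → ≤-trans le (min u Vu) })
...   | no  gt = inj₂ (suc v , Vv , λ { zero _ → <⇒≤ (≰⇒> gt) ; (suc u) Vu → min u Vu })

slack : ∀ {m} o {p} → m + o ≡ p → m ≤ p
slack {m} o m+o≡p = subst (m ≤_) m+o≡p (m≤m+n m o)

-- 2r(q+1) ≤ r(r+1) + (q+1)q: the slack is (r-q-1)(r-q), a product of two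
-- consecutive integers, written out according to the position of q and r.
consecutive : ∀ r q → 2 * r * suc q ≤ r * suc r + suc q * q
consecutive r q with compare q r
... | less _ l      = slack (l * suc l) (below q l)
  where below : ∀ q l → 2 * suc (q + l) * suc q + l * suc l ≡ suc (q + l) * suc (suc (q + l)) + suc q * q
        below = solve-∀
... | equal _       = ≤-reflexive (diagonal q)
  where diagonal : ∀ q → 2 * q * suc q ≡ q * suc q + suc q * q
        diagonal = solve-∀
... | greater _ j   = slack (suc j * suc (suc j)) (above r j)
  where above : ∀ r j → 2 * r * suc (suc (r + j)) + suc j * suc (suc j) ≡ r * suc r + suc (suc (r + j)) * suc (r + j)
        above = solve-∀

-- The weights (2r , r(r+1)) satisfy the hypothesis of the greedy bound below:
-- deleting p ≤ k + 1 vertices of degree at least k.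
greedyWeights : ∀ r p k → p ≤ suc k → 2 * r * p ≤ r * suc r + p * k
greedyWeights r zero    k _         = ≤-trans (≤-reflexive (*-zeroʳ (2 * r))) z≤n
greedyWeights r (suc q) k (s≤s q≤k) =
  ≤-trans (consecutive r q) (+-monoʳ-≤ (r * suc r) (*-monoʳ-≤ (suc q) q≤k))

cancel-average : ∀ r n i → .{{NonZero r}} → 2 * r * n ≤ r * suc r * i + r * n → n ≤ suc r * i
cancel-average r n i bound =
  *-cancelˡ-≤ r (+-cancelʳ-≤ (r * n) (r * n) (r * (suc r * i)) (subst₂ _≤_ (double r n) (regroup r n i) bound))
  where
  double : ∀ r n → 2 * r * n ≡ r * n + r * n
  double = solve-∀
  regroup : ∀ r n i → r * suc r * i + r * n ≡ r * (suc r * i) + r * n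
  regroup = solve-∀

-- A multigraph H on Fin n with c edges (w , i) for every w : Fin n, none of them a loop.
module IndependentSets {n c : ℕ} (edge : Fin n → Fin c → Fin n × Fin n)
                       (loopless : ∀ w i → proj₁ (edge w i) ≢ proj₂ (edge w i)) where

  VertexSet : Set
  VertexSet = Fin n → Bool

  s t : Fin n → Fin c → Fin n
  s w i = proj₁ (edge w i)
  t w i = proj₂ (edge w i)

  ∑E : (Fin n → Fin c → ℕ) → ℕ
  ∑E f = ∑[ w < n ] ∑[ i < c ] f w i

  ∑E-cong : ∀ {f g : Fin n → Fin c → ℕ} → (∀ w i → f w i ≡ g w i) → ∑E f ≡ ∑E g
  ∑E-cong f≡g = sum-cong-≗ (λ w → sum-cong-≗ (f≡g w))

  ∑E-mono : ∀ {f g : Fin n → Fin c → ℕ} → (∀ w i → f w i ≤ g w i) → ∑E f ≤ ∑E g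
  ∑E-mono f≤g = sum-mono (λ w → sum-mono (f≤g w))

  ∑E-+ : ∀ (f g : Fin n → Fin c → ℕ) → ∑E (λ w i → f w i + g w i) ≡ ∑E f + ∑E g
  ∑E-+ f g = trans (sum-cong-≗ (λ w → ∑-distrib-+ (f w) (g w))) (∑-distrib-+ (λ w → sum (f w)) (λ w → sum (g w)))

  ∑E-*ˡ : ∀ x (f : Fin n → Fin c → ℕ) → ∑E (λ w i → x * f w i) ≡ x * ∑E f
  ∑E-*ˡ x f = ≡-sym (trans (*-distribˡ-sum x (λ w → sum (f w))) (sum-cong-≗ (λ w → *-distribˡ-sum x (f w))))

  term≤∑E : ∀ (f : Fin n → Fin c → ℕ) w i → f w i ≤ ∑E f
  term≤∑E f w i = ≤-trans (term≤sum (f w) i) (term≤sum (λ w → sum (f w)) w)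

  Independent : VertexSet → Set
  Independent I = ∀ w i → I (s w i) ≡ true → I (t w i) ≡ true → ⊥

  _⊆_ : VertexSet → VertexSet → Set
  I ⊆ V = ∀ u → I u ≡ true → V u ≡ true

  edgesIn : VertexSet → ℕ
  edgesIn V = ∑E (λ w i → ι (V (s w i) ∧ V (t w i)))

  edgesIn-all : edgesIn (λ _ → true) ≡ n * (c * 1)
  edgesIn-all = trans (sum-cong-≗ {n} (λ w → sum-const c 1)) (sum-const n (c * 1))

  degTo : VertexSet → Fin n → ℕ
  degTo V u = ∑E (λ w i → δ (s w i) u * ι (V (t w i)) + δ (t w i) u * ι (V (s w i)))

  mult : Fin n → Fin n → ℕ
  mult v u = degTo (λ x → does (x ≟ v)) u

  -- The ends of an edge are joined: the edge itself contributes δ t t · δ s s = 1.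
  mult-at-s : ∀ w i → 1 ≤ mult (s w i) (t w i)
  mult-at-s w i = ≤-trans (≤-reflexive (≡-sym (cong₂ _*_ (δ-diag (t w i)) (δ-diag (s w i)))))
    (≤-trans (m≤n+m _ _)
      (term≤∑E (λ w' i' → δ (s w' i') (t w i) * δ (t w' i') (s w i) + δ (t w' i') (t w i) * δ (s w' i') (s w i)) w i))

  mult-at-t : ∀ w i → 1 ≤ mult (t w i) (s w i)
  mult-at-t w i = ≤-trans (≤-reflexive (≡-sym (cong₂ _*_ (δ-diag (s w i)) (δ-diag (t w i)))))
    (≤-trans (m≤m+n _ _)
      (term≤∑E (λ w' i' → δ (s w' i') (s w i) * δ (t w' i') (t w i) + δ (t w' i') (s w i) * δ (s w' i') (t w i)) w i))

  handshake : ∀ (h : Fin n → ℕ) (A B : Fin n → Fin c → ℕ) →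
    ∑[ u < n ] (h u * ∑E (λ w i → δ (s w i) u * A w i + δ (t w i) u * B w i))
      ≡ ∑E (λ w i → h (s w i) * A w i + h (t w i) * B w i)
  handshake h A B = begin
      ∑[ u < n ] (h u * ∑E (F u))                          ≡⟨ sum-cong-≗ (λ u → ≡-sym (∑E-*ˡ (h u) (F u))) ⟩
      ∑[ u < n ] ∑[ w < n ] ∑[ i < c ] (h u * F u w i)      ≡⟨ ∑-comm (λ u w → ∑[ i < c ] (h u * F u w i)) ⟩
      ∑[ w < n ] ∑[ u < n ] ∑[ i < c ] (h u * F u w i)      ≡⟨ sum-cong-≗ (λ w → ∑-comm (λ u i → h u * F u w i)) ⟩
      ∑[ w < n ] ∑[ i < c ] ∑[ u < n ] (h u * F u w i)      ≡⟨ ∑E-cong ends ⟩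
      ∑E (λ w i → h (s w i) * A w i + h (t w i) * B w i)   ∎
    where
    open ≡-Reasoning
    F : Fin n → Fin n → Fin c → ℕ
    F u w i = δ (s w i) u * A w i + δ (t w i) u * B w i
    distribute : ∀ x p a q b → x * (p * a + q * b) ≡ p * (x * a) + q * (x * b)
    distribute = solve-∀
    ends : ∀ w i → ∑[ u < n ] (h u * F u w i) ≡ h (s w i) * A w i + h (t w i) * B w i
    ends w i = begin
        ∑[ u < n ] (h u * F u w i)
      ≡⟨ sum-cong-≗ (λ u → distribute (h u) (δ (s w i) u) (A w i) (δ (t w i) u) (B w i)) ⟩
        ∑[ u < n ] (δ (s w i) u * (h u * A w i) + δ (t w i) u * (h u * B w i))
      ≡⟨ ∑-distrib-+ (λ u → δ (s w i) u * (h u * A w i)) (λ u → δ (t w i) u * (h u * B w i)) ⟩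
        ∑[ u < n ] (δ (s w i) u * (h u * A w i)) + ∑[ u < n ] (δ (t w i) u * (h u * B w i))
      ≡⟨ cong₂ _+_ (sum-δ (s w i) (λ u → h u * A w i)) (sum-δ (t w i) (λ u → h u * B w i)) ⟩
        h (s w i) * A w i + h (t w i) * B w i
      ∎

  -- Truth table for an edge whose ends lie in V (x, y) and in a set N (X, Y):
  -- an edge inside V lies inside V ∖ N or has an end in N.
  edge-split : ∀ x y X Y → ι (x ∧ y) ≡ ι ((x ∧ not X) ∧ (y ∧ not Y)) + ι ((x ∧ y) ∧ (X ∨ Y))
  edge-split false y     X     Y     = refl
  edge-split true  false true  Y     = refl
  edge-split true  false false Y     = refl
  edge-split true  true  true  Y     = refl
  edge-split true  true  false true  = refl
  edge-split true  true  false false = refl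

  -- Truth table, same reading: an edge inside V with an end in N is counted at
  -- most twice when each end in V ∩ N counts its edges into V.
  edge-ends : ∀ x y X Y → ι (x ∧ X) * ι y + ι (y ∧ Y) * ι x ≤ 2 * ι ((x ∧ y) ∧ (X ∨ Y))
  edge-ends true  true  true  true  = byComputation
  edge-ends true  true  true  false = byComputation
  edge-ends true  true  false true  = byComputation
  edge-ends true  true  false false = byComputation
  edge-ends true  false true  true  = byComputation
  edge-ends true  false true  false = byComputation
  edge-ends true  false false true  = byComputation
  edge-ends true  false false false = byComputation
  edge-ends false true  true  true  = byComputation
  edge-ends false true  true  false = byComputation
  edge-ends false true  false true  = byComputation
  edge-ends false true  false false = byComputation
  edge-ends false false true  true  = byComputation
  edge-ends false false true  false = byComputation
  edge-ends false false false true  = byComputation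
  edge-ends false false false false = byComputation

  -- A vertex u of V (x) lies in N[v] only if u = v (e) or u is joined to v
  -- (m times); so its indicator is at most e + x·m.
  closed-bound : ∀ x e m → ι (x ∧ (e ∨ (0 <ᵇ m))) ≤ ι e + ι x * m
  closed-bound false e     m       = z≤n
  closed-bound true  true  m       = s≤s z≤n
  closed-bound true  false zero    = z≤n
  closed-bound true  false (suc m) = s≤s z≤n

  -- The greedy algorithm: repeatedly put a vertex v of minimum degree into I and
  -- delete its closed neighbourhood.
  module Greedy (a b : ℕ) (weights : ∀ p k → p ≤ suc k → a * p ≤ b + p * k) where

    Outcome : VertexSet → Set
    Outcome V = Σ[ I ∈ VertexSet ] (I ⊆ V × Independent I × a * count V ≤ b * count I + 2 * edgesIn V)

    module Step (V : VertexSet) (v : Fin n) (v∈V : V v ≡ true)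
                (minimal : ∀ u → V u ≡ true → degTo V v ≤ degTo V u) where

      k : ℕ
      k = degTo V v

      closed : VertexSet
      closed u = does (v ≟ u) ∨ (0 <ᵇ mult v u)

      removed rest : VertexSet
      removed u = V u ∧ closed u
      rest u = V u ∧ not (closed u)

      -- The edges of V with an end in N[v]; they disappear with N[v].
      boundary : ℕ
      boundary = ∑E (λ w i → ι ((V (s w i) ∧ V (t w i)) ∧ (closed (s w i) ∨ closed (t w i))))

      count-V : count V ≡ count rest + count removed
      count-V = count-split V closed

      edges-V : edgesIn V ≡ edgesIn rest + boundary
      edges-V = trans (∑E-cong (λ w i → edge-split (V (s w i)) (V (t w i)) (closed (s w i)) (closed (t w i))))
                      (∑E-+ (λ w i → ι (rest (s w i) ∧ rest (t w i)))
                            (λ w i → ι ((V (s w i) ∧ V (t w i)) ∧ (closed (s w i) ∨ closed (t w i)))))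

      v-closed : closed v ≡ true
      v-closed = cong (_∨ (0 <ᵇ mult v v)) (dec-true (v ≟ v) refl)

      rest-smaller : suc (count rest) ≤ count V
      rest-smaller = begin
          suc (count rest)            ≡⟨ +-comm 1 (count rest) ⟩
          count rest + 1              ≤⟨ +-monoʳ-≤ (count rest) v-counted ⟩
          count rest + count removed  ≡⟨ ≡-sym count-V ⟩
          count V                     ∎
        where
        open ≤-Reasoning
        v-counted : 1 ≤ count removed
        v-counted = ≤-trans (≤-reflexive (cong ι (≡-sym (cong₂ _∧_ v∈V v-closed)))) (term≤sum (λ u → ι (removed u)) v)

      -- Apart from v itself, every removed vertex is joined to v, so |N[v] ∩ V| ≤ k + 1.
      removed-small : count removed ≤ suc k
      removed-small = begin
          count removed
        ≤⟨ sum-mono (λ u → closed-bound (V u) (does (v ≟ u)) (mult v u)) ⟩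
          ∑[ u < n ] (δ v u + ι (V u) * mult v u)
        ≡⟨ ∑-distrib-+ (δ v) (λ u → ι (V u) * mult v u) ⟩
          ∑[ u < n ] δ v u + ∑[ u < n ] (ι (V u) * mult v u)
        ≡⟨ cong₂ _+_ (sum-δ-one v) (handshake (λ u → ι (V u)) (λ w i → δ (t w i) v) (λ w i → δ (s w i) v)) ⟩
          1 + ∑E (λ w i → ι (V (s w i)) * δ (t w i) v + ι (V (t w i)) * δ (s w i) v)
        ≡⟨ cong suc (∑E-cong (λ w i → swap (ι (V (s w i))) (δ (t w i) v) (ι (V (t w i))) (δ (s w i) v))) ⟩
          suc k
        ∎
        where
        open ≤-Reasoning
        swap : ∀ x p y q → x * p + y * q ≡ q * y + p * x
        swap = solve-∀

      -- Every removed vertex has degree at least k in V, and summing these degrees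
      -- counts every boundary edge at most twice.
      removed-degrees : count removed * k ≤ 2 * boundary
      removed-degrees = begin
          count removed * k
        ≡⟨ trans (*-comm (count removed) k) (*-distribˡ-sum k (λ u → ι (removed u))) ⟩
          ∑[ u < n ] (k * ι (removed u))
        ≤⟨ sum-mono at-least-k ⟩
          ∑[ u < n ] (ι (removed u) * degTo V u)
        ≡⟨ handshake (λ u → ι (removed u)) (λ w i → ι (V (t w i))) (λ w i → ι (V (s w i))) ⟩
          ∑E (λ w i → ι (removed (s w i)) * ι (V (t w i)) + ι (removed (t w i)) * ι (V (s w i)))
        ≤⟨ ∑E-mono (λ w i → edge-ends (V (s w i)) (V (t w i)) (closed (s w i)) (closed (t w i))) ⟩
          ∑E (λ w i → 2 * ι ((V (s w i) ∧ V (t w i)) ∧ (closed (s w i) ∨ closed (t w i))))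
        ≡⟨ ∑E-*ˡ 2 (λ w i → ι ((V (s w i) ∧ V (t w i)) ∧ (closed (s w i) ∨ closed (t w i)))) ⟩
          2 * boundary
        ∎
        where
        open ≤-Reasoning
        at-least-k : ∀ u → k * ι (removed u) ≤ ι (removed u) * degTo V u
        at-least-k u with V u in V-u | closed u
        ... | false | _     = ≤-reflexive (*-zeroʳ k)
        ... | true  | false = ≤-reflexive (*-zeroʳ k)
        ... | true  | true  = ≤-trans (≤-reflexive (*-identityʳ k))
                                      (≤-trans (minimal u V-u) (≤-reflexive (≡-sym (+-identityʳ (degTo V u)))))

      removed-weight : a * count removed ≤ b + 2 * boundary
      removed-weight = ≤-trans (weights (count removed) k removed-small) (+-monoʳ-≤ b removed-degrees)

      rest-open : ∀ u → rest u ≡ true → closed u ≡ false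
      rest-open u u∈rest = not-injective (∧-conicalʳ (V u) (not (closed u)) u∈rest)

      joined-closed : ∀ u → 1 ≤ mult v u → closed u ≡ true
      joined-closed u joined = trans (cong (does (v ≟ u) ∨_) (positive joined)) (∨-zeroʳ (does (v ≟ u)))
        where
        positive : ∀ {m} → 1 ≤ m → (0 <ᵇ m) ≡ true
        positive (s≤s _) = refl

      -- Adding v to an independent subset of the rest keeps it independent,
      -- since every edge at v ends in N[v].
      with-v : VertexSet → VertexSet
      with-v I u = does (v ≟ u) ∨ I u

      with-v-⊆ : ∀ I → I ⊆ rest → with-v I ⊆ V
      with-v-⊆ I I⊆rest u u∈I with v ≟ u
      ... | yes refl = v∈V
      ... | no _     = ∧-conicalˡ (V u) (not (closed u)) (I⊆rest u u∈I)

      with-v-independent : ∀ I → I ⊆ rest → Independent I → Independent (with-v I)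
      with-v-independent I I⊆rest independent w i s∈I t∈I with v ≟ s w i | v ≟ t w i
      ... | yes v≡s | yes v≡t = loopless w i (trans (≡-sym v≡s) v≡t)
      ... | yes v≡s | no _    = false≢true (trans (≡-sym (rest-open (t w i) (I⊆rest (t w i) t∈I)))
                                  (joined-closed (t w i) (subst (λ x → 1 ≤ mult x (t w i)) (≡-sym v≡s) (mult-at-s w i))))
      ... | no _    | yes v≡t = false≢true (trans (≡-sym (rest-open (s w i) (I⊆rest (s w i) s∈I)))
                                  (joined-closed (s w i) (subst (λ x → 1 ≤ mult x (s w i)) (≡-sym v≡t) (mult-at-t w i))))
      ... | no _    | no _    = independent w i s∈I t∈I

      count-with-v : ∀ I → I ⊆ rest → count (with-v I) ≡ suc (count I)
      count-with-v I I⊆rest =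
        trans (sum-cong-≗ pointwise) (trans (∑-distrib-+ (δ v) (λ u → ι (I u))) (cong (_+ count I) (sum-δ-one v)))
        where
        v∉I : I v ≡ false
        v∉I with I v in v∈I
        ... | false = refl
        ... | true  = ⊥-elim (false≢true (trans (≡-sym (rest-open v (I⊆rest v v∈I))) v-closed))
        pointwise : ∀ u → ι (with-v I u) ≡ δ v u + ι (I u)
        pointwise u with v ≟ u
        ... | yes refl = cong (λ x → suc (ι x)) (≡-sym v∉I)
        ... | no _     = refl

      -- The outcome for the rest, plus v, is an outcome for V: the weight of the
      -- removed vertices is paid by v and the boundary edges.
      extend : Outcome rest → Outcome V
      extend (I , I⊆rest , independent , bound) =
        with-v I , with-v-⊆ I I⊆rest , with-v-independent I I⊆rest independent , (begin
          a * count V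
        ≡⟨ trans (cong (a *_) count-V) (*-distribˡ-+ a (count rest) (count removed)) ⟩
          a * count rest + a * count removed
        ≤⟨ +-mono-≤ bound removed-weight ⟩
          (b * count I + 2 * edgesIn rest) + (b + 2 * boundary)
        ≡⟨ collect b (count I) (edgesIn rest) boundary ⟩
          b * suc (count I) + 2 * (edgesIn rest + boundary)
        ≡⟨ ≡-sym (cong₂ (λ x y → b * x + 2 * y) (count-with-v I I⊆rest) edges-V) ⟩
          b * count (with-v I) + 2 * edgesIn V
        ∎)
        where
        open ≤-Reasoning
        collect : ∀ b i e x → (b * i + 2 * e) + (b + 2 * x) ≡ b * suc i + 2 * (e + x)
        collect = solve-∀

    greedy : ∀ fuel (V : VertexSet) → count V ≤ fuel → Outcome V
    greedy fuel V small with argmin V (degTo V)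
    ... | inj₁ empty = (λ _ → false) , (λ _ ()) , (λ _ _ ()) ,
                       ≤-trans (≤-reflexive (trans (cong (a *_) (count-empty V empty)) (*-zeroʳ a))) z≤n
    greedy zero V small | inj₂ (v , v∈V , minimal) with ≤-trans (Step.rest-smaller V v v∈V minimal) small
    ... | ()
    greedy (suc fuel) V small | inj₂ (v , v∈V , minimal) =
      Step.extend V v v∈V minimal (greedy fuel (Step.rest V v v∈V minimal)
                                     (≤-pred (≤-trans (Step.rest-smaller V v v∈V minimal) small)))

  -- Caro–Wei type bound: H has c·n edges, i.e. average degree 2c, and has an
  -- independent set I with n ≤ (2c + 1)·|I|.
  largeIndependentSet : .{{NonZero c}} → Σ[ I ∈ VertexSet ] (Independent I × n ≤ suc (2 * c) * count I)
  largeIndependentSet with Greedy.greedy (2 * (2 * c)) (2 * c * suc (2 * c)) (greedyWeights (2 * c))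
                                         n (λ _ → true) (≤-reflexive (count-all n))
  ... | I , _ , independent , bound =
    I , independent , cancel-average (2 * c) n (count I)
                        (subst₂ (λ m e → 2 * (2 * c) * m ≤ 2 * c * suc (2 * c) * count I + e)
                                (count-all n) (trans (cong (2 *_) edgesIn-all) (average n c)) bound)
    where
    instance
      2c≢0 : NonZero (2 * c)
      2c≢0 = m*n≢0 2 c
    average : ∀ n c → 2 * (n * (c * 1)) ≡ 2 * c * n
    average = solve-∀

length-filter-tabulate : ∀ {A : Set} {P : A → Set} (P? : ∀ x → Dec (P x)) {k} (f : Fin k → A) →
                         length (filter P? (List.tabulate f)) ≡ ∑[ i < k ] ι (does (P? (f i)))
length-filter-tabulate P? {zero}  f = refl
length-filter-tabulate P? {suc k} f with does (P? (f zero))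
... | true  = cong suc (length-filter-tabulate P? (f ∘ suc))
... | false = length-filter-tabulate P? (f ∘ suc)

deg-count : ∀ {n} (G : Graph n) v → deg G v ≡ count (λ u → does (adj? G v u))
deg-count G v = length-filter-tabulate (adj? G v) (λ u → u)

degIn-count : ∀ {n} (G : Graph n) S v → degIn G S v ≡ count (λ u → does ((u ∈? S) ×-dec adj? G v u))
degIn-count G S v = length-filter-tabulate (λ u → (u ∈? S) ×-dec adj? G v u) (λ u → u)

complement : ∀ {n} → (Fin n → Bool) → Subset n
complement I = tabulate (not ∘ I)

size-tabulate : ∀ {n} (g : Fin n → Bool) → ∣ tabulate g ∣ ≡ count g
size-tabulate {zero}  g = refl
size-tabulate {suc n} g with g zero
... | true  = cong suc (size-tabulate (g ∘ suc))
... | false = size-tabulate (g ∘ suc)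

size-complement : ∀ {n} (I : Fin n → Bool) → ∣ complement I ∣ + count I ≡ n
size-complement {n} I = begin
    ∣ complement I ∣ + count I                   ≡⟨ cong (_+ count I) (size-tabulate (not ∘ I)) ⟩
    count (not ∘ I) + count I                    ≡⟨ ≡-sym (∑-distrib-+ (λ u → ι (not (I u))) (λ u → ι (I u))) ⟩
    ∑[ u < n ] (ι (not (I u)) + ι (I u))         ≡⟨ sum-cong-≗ (λ u → one (I u)) ⟩
    count {n} (λ _ → true)                       ≡⟨ count-all n ⟩
    n                                            ∎
  where
  open ≡-Reasoning
  one : ∀ b → ι (not b) + ι b ≡ 1
  one true  = refl
  one false = refl

∉⇒∈complement : ∀ {n} (I : Fin n → Bool) {x} → I x ≡ false → x ∈ complement I
∉⇒∈complement I {x} x∉I = lookup⇒[]= x (complement I) (trans (lookup∘tabulate (not ∘ I) x) (cong not x∉I))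

two-outside : ∀ {n} (G : Graph n) (I : Fin n → Bool) v {x y} → x ≢ y → Adj G v x → Adj G v y →
              I x ≡ false → I y ≡ false → 2 ≤ degIn G (complement I) v
two-outside G I v {x} {y} x≢y vx vy x∉I y∉I = ≤-trans
  (count≥2 (λ u → does ((u ∈? complement I) ×-dec adj? G v u)) x≢y
           (dec-true ((x ∈? complement I) ×-dec adj? G v x) (∉⇒∈complement I x∉I , vx))
           (dec-true ((y ∈? complement I) ×-dec adj? G v y) (∉⇒∈complement I y∉I , vy)))
  (≤-reflexive (≡-sym (degIn-count G (complement I) v)))

record Neighbours {n} (G : Graph n) (v : Fin n) (k : ℕ) : Set where
  field
    nb        : Fin k → Fin n
    injective : Injective _≡_ _≡_ nb
    adjacent  : ∀ i → Adj G v (nb i)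

  distinct : ∀ {i j} → i ≢ j → nb i ≢ nb j
  distinct i≢j nbi≡nbj = i≢j (injective nbi≡nbj)

neighbours : ∀ {n} (G : Graph n) {k} → MinDegreeAtLeast G k → ∀ v → Neighbours G v k
neighbours G {k} δ≥k v with pickDistinct k (λ u → does (adj? G v u)) (≤-trans (δ≥k v) (≤-reflexive (deg-count G v)))
... | f , f-inj , adjacent = record { nb = f ; injective = f-inj ; adjacent = λ i → does⇒ (adj? G v (f i)) (adjacent i) }

module _ {n} {G : Graph n} {v : Fin n} (N : Neighbours G v 3) where
  open Neighbours N

  two-of-three : ∀ (I : Fin n → Bool) →
                 (I (nb zero) ≡ true → I (nb (suc zero)) ≡ true → ⊥) →
                 (I (nb (suc zero)) ≡ true → I (nb (suc (suc zero))) ≡ true → ⊥) →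
                 (I (nb zero) ≡ true → I (nb (suc (suc zero))) ≡ true → ⊥) →
                 2 ≤ degIn G (complement I) v
  two-of-three I not-ab not-bc not-ac
    with I (nb zero) in a∉I | I (nb (suc zero)) in b∉I | I (nb (suc (suc zero))) in c∉I
  ... | false | false | _     = two-outside G I v (distinct (λ ())) (adjacent _) (adjacent _) a∉I b∉I
  ... | false | true  | false = two-outside G I v (distinct (λ ())) (adjacent _) (adjacent _) a∉I c∉I
  ... | true  | false | false = two-outside G I v (distinct (λ ())) (adjacent _) (adjacent _) b∉I c∉I
  ... | true  | true  | _     = ⊥-elim (not-ab refl refl)
  ... | false | true  | true  = ⊥-elim (not-bc refl refl)
  ... | true  | false | true  = ⊥-elim (not-ac refl refl)

module _ {n} {G : Graph n} {v : Fin n} (N : Neighbours G v 4) where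
  open Neighbours N

  two-of-four : ∀ (I : Fin n → Bool) →
                (I (nb zero) ≡ true → I (nb (suc zero)) ≡ true → ⊥) →
                (I (nb (suc (suc zero))) ≡ true → I (nb (suc (suc (suc zero)))) ≡ true → ⊥) →
                2 ≤ degIn G (complement I) v
  two-of-four I not-ab not-cd
    with I (nb zero) in a∉I | I (nb (suc zero)) in b∉I | I (nb (suc (suc zero))) in c∉I
       | I (nb (suc (suc (suc zero)))) in d∉I
  ... | true  | true  | _     | _     = ⊥-elim (not-ab refl refl)
  ... | _     | _     | true  | true  = ⊥-elim (not-cd refl refl)
  ... | false | _     | false | _     = two-outside G I v (distinct (λ ())) (adjacent _) (adjacent _) a∉I c∉I
  ... | false | _     | true  | false = two-outside G I v (distinct (λ ())) (adjacent _) (adjacent _) a∉I d∉I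
  ... | true  | false | false | _     = two-outside G I v (distinct (λ ())) (adjacent _) (adjacent _) b∉I c∉I
  ... | true  | false | true  | false = two-outside G I v (distinct (λ ())) (adjacent _) (adjacent _) b∉I d∉I

record PairScheme {n} (G : Graph n) (c : ℕ) : Set where
  field
    pair      : Fin n → Fin c → Fin n × Fin n
    distinct  : ∀ v i → proj₁ (pair v i) ≢ proj₂ (pair v i)
    dominates : ∀ (I : Fin n → Bool) v →
                (∀ i → I (proj₁ (pair v i)) ≡ true → I (proj₂ (pair v i)) ≡ true → ⊥) →
                2 ≤ degIn G (complement I) v

complement-bound : ∀ r n i s → s + i ≡ n → n ≤ suc r * i → suc r * s ≤ r * n
complement-bound r n i s s+i≡n n≤ = +-cancelʳ-≤ n (suc r * s) (r * n) (begin
    suc r * s + n            ≤⟨ +-monoʳ-≤ (suc r * s) n≤ ⟩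
    suc r * s + suc r * i    ≡⟨ ≡-sym (*-distribˡ-+ (suc r) s i) ⟩
    suc r * (s + i)          ≡⟨ cong (suc r *_) s+i≡n ⟩
    suc r * n                ≡⟨ +-comm n (r * n) ⟩
    r * n + n                ∎)
  where open ≤-Reasoning

-- A pair scheme with c pairs per vertex yields a (2,2)-dominating set of size
-- at most 2c/(2c+1)·n: the complement of a large independent set of the pairs.
schemeBound : ∀ {n} {G : Graph n} {c} .{{_ : NonZero c}} → PairScheme G c →
              Σ[ S ∈ Subset n ] (IsDominating G 2 2 S × suc (2 * c) * ∣ S ∣ ≤ 2 * c * n)
schemeBound {n} {G} {c} scheme = fromIndependent (largeIndependentSet pair distinct)
  where
  open PairScheme scheme
  open IndependentSets using (Independent; largeIndependentSet)
  fromIndependent : Σ[ I ∈ (Fin n → Bool) ] (Independent pair distinct I × n ≤ suc (2 * c) * count I) →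
                    Σ[ S ∈ Subset n ] (IsDominating G 2 2 S × suc (2 * c) * ∣ S ∣ ≤ 2 * c * n)
  fromIndependent (I , independent , large) =
    complement I , ((λ v _ → dominates I v (independent v)) , (λ v _ → dominates I v (independent v))) ,
    complement-bound (2 * c) n (count I) ∣ complement I ∣ (size-complement I) large

triangleScheme : ∀ {n} (G : Graph n) → MinDegreeAtLeast G 3 → PairScheme G 3
triangleScheme {n} G δ≥3 = record
  { pair      = pair
  ; distinct  = λ { v zero             → distinct (N v) {zero} {suc zero} (λ ())
                  ; v (suc zero)       → distinct (N v) {suc zero} {suc (suc zero)} (λ ())
                  ; v (suc (suc zero)) → distinct (N v) {zero} {suc (suc zero)} (λ ()) }
  ; dominates = λ I v free → two-of-three (N v) I (free zero) (free (suc zero)) (free (suc (suc zero)))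
  }
  where
  open Neighbours
  N : ∀ v → Neighbours G v 3
  N = neighbours G δ≥3
  pair : Fin n → Fin 3 → Fin n × Fin n
  pair v zero             = nb (N v) zero , nb (N v) (suc zero)
  pair v (suc zero)       = nb (N v) (suc zero) , nb (N v) (suc (suc zero))
  pair v (suc (suc zero)) = nb (N v) zero , nb (N v) (suc (suc zero))

quadrupleScheme : ∀ {n} (G : Graph n) → MinDegreeAtLeast G 4 → PairScheme G 2
quadrupleScheme {n} G δ≥4 = record
  { pair      = pair
  ; distinct  = λ { v zero       → distinct (N v) {zero} {suc zero} (λ ())
                  ; v (suc zero) → distinct (N v) {suc (suc zero)} {suc (suc (suc zero))} (λ ()) }
  ; dominates = λ I v free → two-of-four (N v) I (free zero) (free (suc zero))
  }
  where
  open Neighbours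
  N : ∀ v → Neighbours G v 4
  N = neighbours G δ≥4
  pair : Fin n → Fin 2 → Fin n × Fin n
  pair v zero       = nb (N v) zero , nb (N v) (suc zero)
  pair v (suc zero) = nb (N v) (suc (suc zero)) , nb (N v) (suc (suc (suc zero)))

mainTheorem2 : (∀ (n : ℕ) (G : Graph n) → MinDegreeAtLeast G 3 →
                  Σ[ S ∈ Subset n ] (IsDominating G 2 2 S × 7 * ∣ S ∣ ≤ 6 * n))
               × (∀ (n : ℕ) (G : Graph n) → MinDegreeAtLeast G 4 →
                  Σ[ S ∈ Subset n ] (IsDominating G 2 2 S × 5 * ∣ S ∣ ≤ 4 * n))
mainTheorem2 = (λ n G δ≥3 → schemeBound (triangleScheme G δ≥3))
             , (λ n G δ≥4 → schemeBound (quadrupleScheme G δ≥4))
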